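{- Let $G$ be a polyhedral embedding on a closed surface, $G^*$ its geometric dual, and $\tau$ an edge-assignment of $G$. Let $H_\tau:=G-\{\tau(f): f\in V(G^*)\}$ (delete these edges, keep all vertices), and for $v\in V(G)$ let $G^*_v:=\{f\in V(G^*): v \text{ is on the face } f \text{ but is not an endpoint of } \tau(f)\}$. Then $|G^*_v|=d_{H_\tau}(v)$ for every $v\in V(G)$.
   Context: All graphs are simple, undirected and finite. A closed surface is a compact connected 2-manifold without boundary. A graph $G$ embedded in a closed surface is a polyhedral embedding if all facial walks are cycles and any two facial walks are either disjoint or intersect in a single vertex or a single edge. $G^*$ is the geometric dual (vertices are faces of $G$). An edge-assignment of $G$ is an injective map $\tau:V(G^*)\to E(G)$ such that $\tau(f)$ lies on the boundary of the face $f$ for every $f$. $d_K(v)$ denotes the degree of $v$ in $K$. -}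

module Defs where

open import Data.Nat using (ℕ; zero; suc; _+_; _≤_)
import Data.Nat as ℕ
open import Data.Fin using (Fin; zero; suc; toℕ; lower₁)
open import Data.Fin.Properties using (any?) renaming (_≟_ to _≟ᶠ_)
open import Data.Product using (Σ; ∃; _×_; _,_; proj₁; proj₂)
open import Data.Sum using (_⊎_; inj₁; inj₂)
open import Relation.Binary.PropositionalEquality using (_≡_; _≢_; refl)
open import Relation.Nullary using (¬_; Dec; yes; no; _×-dec_; _⊎-dec_; ¬?)
open import Function.Definitions using (Injective)
open import Function.Bundles using (_⇔_)

count : ∀ {N} (P : Fin N → Set) → (∀ i → Dec (P i)) → ℕ
count {zero}  P P? = 0
count {suc N} P P? with P? zero
... | yes _ = suc (count (λ i → P (suc i)) (λ i → P? (suc i)))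
... | no  _ = count (λ i → P (suc i)) (λ i → P? (suc i))

next : ∀ {L} → Fin L → Fin L
next {suc L} i with L ℕ.≟ toℕ i
... | yes _ = zero
... | no p  = suc (lower₁ i p)

record Graph : Set where
  field
    n    : ℕ
    m    : ℕ
    end₁ : Fin m → Fin n
    end₂ : Fin m → Fin n
    loopless : ∀ e → end₁ e ≢ end₂ e
    simple   : ∀ e e' →
      ((end₁ e ≡ end₁ e' × end₂ e ≡ end₂ e') ⊎ (end₁ e ≡ end₂ e' × end₂ e ≡ end₁ e'))
      → e ≡ e'

  Inc : Fin m → Fin n → Set
  Inc e v = (v ≡ end₁ e) ⊎ (v ≡ end₂ e)

  Inc? : ∀ e v → Dec (Inc e v)
  Inc? e v = (v ≟ᶠ end₁ e) ⊎-dec (v ≟ᶠ end₂ e)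

  Joins : Fin m → Fin n → Fin n → Set
  Joins e u w = (end₁ e ≡ u × end₂ e ≡ w) ⊎ (end₁ e ≡ w × end₂ e ≡ u)

  data Reach : Fin n → Fin n → Set where
    here : ∀ {v} → Reach v v
    step : ∀ {u w x} e → Joins e u w → Reach w x → Reach u x

  Connected : Set
  Connected = ∀ u v → Reach u v

-- A polyhedral embedding of G in a closed surface, given combinatorially
-- by its faces.  The complex obtained by gluing a
-- disc along each facial cycle is a closed surface: every edge lies on
-- exactly two faces, and around every vertex v the incident edges and
-- faces alternate in a single cyclic order e₀ f₀ e₁ f₁ … e_{d-1} f_{d-1}
-- (face f_i contains e_i and e_{i+1}) — i.e. v has a disc neighbourhood;
-- G is connected (so the surface is connected).

record PolyhedralEmbedding (G : Graph) : Set where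
  open Graph G
  field
    k     : ℕ                                  -- number of faces = |V(G*)|
    len   : Fin k → ℕ
    len≥3 : ∀ f → 3 ≤ len f
    vert  : (f : Fin k) → Fin (len f) → Fin n
    vert-inj : ∀ f → Injective _≡_ _≡_ (vert f)
    edge  : (f : Fin k) → Fin (len f) → Fin m
    edge-joins : ∀ f i → Joins (edge f i) (vert f i) (vert f (next i))

  OnV : Fin k → Fin n → Set
  OnV f v = ∃ λ i → vert f i ≡ v

  OnE : Fin k → Fin m → Set
  OnE f e = ∃ λ i → edge f i ≡ e

  field
    connected : Connected
    edge-two-faces : ∀ e → Σ (Fin k) λ f₁ → Σ (Fin k) λ f₂ →
      f₁ ≢ f₂ × OnE f₁ e × OnE f₂ e × (∀ f → OnE f e → (f ≡ f₁ ⊎ f ≡ f₂))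
    vertex-wheel : ∀ v → Σ ℕ λ d → Σ (Fin d → Fin m) λ ε → Σ (Fin d → Fin k) λ φ →
      Injective _≡_ _≡_ ε × Injective _≡_ _≡_ φ
      × (∀ e → Inc e v ⇔ (∃ λ i → ε i ≡ e))
      × (∀ f → OnV f v ⇔ (∃ λ i → φ i ≡ f))
      × (∀ i → OnE (φ i) (ε i) × OnE (φ i) (ε (next i)))
    polyhedral : ∀ f f' → f ≢ f' →
      (∀ v → ¬ (OnV f v × OnV f' v))
      ⊎ (Σ (Fin n) λ u → ∀ v → (OnV f v × OnV f' v) ⇔ (v ≡ u))
      ⊎ (Σ (Fin m) λ e → OnE f e × OnE f' e × (∀ v → (OnV f v × OnV f' v) ⇔ Inc e v))

  OnV? : ∀ f v → Dec (OnV f v)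
  OnV? f v = any? (λ i → vert f i ≟ᶠ v)

  record EdgeAssignment : Set where
    field
      τ     : Fin k → Fin m
      τ-inj : Injective _≡_ _≡_ τ
      τ-on  : ∀ f → OnE f (τ f)

    InH : Fin m → Set
    InH e = ¬ (∃ λ f → τ f ≡ e)

    degH : Fin n → ℕ
    degH v = count (λ e → InH e × Inc e v)
                   (λ e → ¬? (any? (λ f → τ f ≟ᶠ e)) ×-dec Inc? e v)

    InG*ᵥ : Fin n → Fin k → Set
    InG*ᵥ v f = OnV f v × ¬ Inc (τ f) v

    sizeG*ᵥ : Fin n → ℕ
    sizeG*ᵥ v = count (InG*ᵥ v) (λ f → OnV? f v ×-dec ¬? (Inc? (τ f) v))

{-# OPTIONS --safe #-}

-- Since every vertex v has a disc neighbourhood, v lies on exactly as many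
-- faces as it has incident edges.  Split the faces at v into those whose
-- assigned edge τ f contains v and the rest, G*_v; split the edges at v into
-- the assigned ones and the rest, the edges of H_τ.  As τ is injective and the
-- ends of τ f lie on f, τ maps the first kind of faces bijectively onto the
-- assigned edges at v, so the remaining parts have the same size.

module Submission where

open import Defs
open import Data.Fin using (Fin; zero; suc)
open import Data.Fin.Properties using (any?; suc-injective; 0≢1+n) renaming (_≟_ to _≟ᶠ_)
open import Data.Nat using (ℕ; zero; suc; _+_; _≤_; z≤n; s≤s)
open import Data.Nat.Properties using (≤-antisym; +-suc; +-cancelˡ-≡)
open import Data.Product using (∃; _,_; proj₁; proj₂; map₂; swap)
open import Data.Sum using (inj₁; inj₂)
open import Data.Unit using (tt)
open import Function using (_∘_)
open import Function.Bundles using (_⇔_; Equivalence)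
open import Function.Definitions using (Injective)
open import Level using (0ℓ)
open import Relation.Binary.PropositionalEquality using (_≡_; refl; sym; trans; cong; subst; module ≡-Reasoning)
open import Relation.Nullary using (yes; no; contradiction)
open import Relation.Unary using (Pred; Decidable; U; _≐_; _∩_; _∖_)
open import Relation.Unary.Properties using (U?; _∩?_; ∁?)

private
  variable
    N M : ℕ

count-cong : {P Q : Pred (Fin N) 0ℓ} (P? : Decidable P) (Q? : Decidable Q) →
             P ≐ Q → count P P? ≡ count Q Q?
count-cong {zero}  P? Q? P≐Q = refl
count-cong {suc N} P? Q? (P⊆Q , Q⊆P) with P? zero | Q? zero
... | yes _  | yes _  = cong suc (count-cong (P? ∘ suc) (Q? ∘ suc) (P⊆Q , Q⊆P))
... | no  _  | no  _  = count-cong (P? ∘ suc) (Q? ∘ suc) (P⊆Q , Q⊆P)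
... | yes p  | no ¬q  = contradiction (P⊆Q p) ¬q
... | no ¬p  | yes q  = contradiction (Q⊆P q) ¬p

count-U : count {N} U U? ≡ N
count-U {zero}  = refl
count-U {suc N} = cong suc count-U

count-split : {P : Pred (Fin N) 0ℓ} (Q : Pred (Fin N) 0ℓ) (P? : Decidable P) (Q? : Decidable Q) →
              count P P? ≡ count (P ∩ Q) (P? ∩? Q?) + count (P ∖ Q) (P? ∩? ∁? Q?)
count-split {zero}  Q P? Q? = refl
count-split {suc N} Q P? Q? with P? zero | Q? zero
... | yes _ | yes _ = cong suc (count-split (Q ∘ suc) (P? ∘ suc) (Q? ∘ suc))
... | yes _ | no  _ = trans (cong suc (count-split (Q ∘ suc) (P? ∘ suc) (Q? ∘ suc))) (sym (+-suc _ _))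
... | no  _ | _     = count-split (Q ∘ suc) (P? ∘ suc) (Q? ∘ suc)

private
  count-∖-suc : {Q : Pred (Fin (suc N)) 0ℓ} (Q? : Decidable Q) {j : Fin N} →
                count ((Q ∘ suc) ∖ (_≡ j)) ((Q? ∘ suc) ∩? ∁? (_≟ᶠ j))
                ≡ count ((Q ∖ (_≡ suc j)) ∘ suc) ((Q? ∩? ∁? (_≟ᶠ suc j)) ∘ suc)
  count-∖-suc Q? {j} = count-cong ((Q? ∘ suc) ∩? ∁? (_≟ᶠ j)) ((Q? ∩? ∁? (_≟ᶠ suc j)) ∘ suc)
    (map₂ (_∘ suc-injective) , map₂ (_∘ cong suc))

count-remove : {Q : Pred (Fin N) 0ℓ} (Q? : Decidable Q) {j : Fin N} → Q j →
               count Q Q? ≡ suc (count (Q ∖ (_≡ j)) (Q? ∩? ∁? (_≟ᶠ j)))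
count-remove {suc N} Q? {zero} q with Q? zero
... | yes _ = cong suc (count-cong (Q? ∘ suc) _ ((_, λ ()) , proj₁))
... | no ¬q = contradiction q ¬q
count-remove {suc N} Q? {suc j} q with Q? zero
... | yes _ = cong suc (trans (count-remove (Q? ∘ suc) q) (cong suc (count-∖-suc Q?)))
... | no  _ = trans (count-remove (Q? ∘ suc) q) (cong suc (count-∖-suc Q?))

record PredInjection (P : Pred (Fin N) 0ℓ) (Q : Pred (Fin M) 0ℓ) : Set where
  field
    to       : ∀ {i} → P i → Fin M
    to-∈     : ∀ {i} (p : P i) → Q (to p)
    to-inj   : ∀ {i j} (p : P i) (p′ : P j) → to p ≡ to p′ → i ≡ j

restrict-suc : {P : Pred (Fin (suc N)) 0ℓ} {Q : Pred (Fin M) 0ℓ} →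
               PredInjection P Q → PredInjection (P ∘ suc) Q
restrict-suc h = record
  { to     = to
  ; to-∈   = to-∈
  ; to-inj = λ p p′ → suc-injective ∘ to-inj p p′
  }
  where open PredInjection h

count-mono : {P : Pred (Fin N) 0ℓ} {Q : Pred (Fin M) 0ℓ} (P? : Decidable P) (Q? : Decidable Q) →
             PredInjection P Q → count P P? ≤ count Q Q?
count-mono {zero}  P? Q? h = z≤n
count-mono {suc N} {P = P} {Q = Q} P? Q? h with P? zero
... | no  _  = count-mono (P? ∘ suc) Q? (restrict-suc h)
... | yes p₀ = subst (_ ≤_) (sym (count-remove Q? (to-∈ p₀)))
                 (s≤s (count-mono (P? ∘ suc) (Q? ∩? ∁? (_≟ᶠ to p₀)) avoiding-to-p₀))
  where
  open PredInjection h

  avoiding-to-p₀ : PredInjection (P ∘ suc) (Q ∖ (_≡ to p₀))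
  avoiding-to-p₀ = record
    { to     = to
    ; to-∈   = λ p → to-∈ p , λ eq → 0≢1+n (sym (to-inj p p₀ eq))
    ; to-inj = λ p p′ → suc-injective ∘ to-inj p p′
    }

count-≡ : {P : Pred (Fin N) 0ℓ} {Q : Pred (Fin M) 0ℓ} (P? : Decidable P) (Q? : Decidable Q) →
          PredInjection P Q → PredInjection Q P → count P P? ≡ count Q Q?
count-≡ P? Q? P↣Q Q↣P = ≤-antisym (count-mono P? Q? P↣Q) (count-mono Q? P? Q↣P)

count-enumeration : {P : Pred (Fin N) 0ℓ} (P? : Decidable P) (ε : Fin M → Fin N) →
                    Injective _≡_ _≡_ ε → (∀ x → P x ⇔ ∃ λ i → ε i ≡ x) → count P P? ≡ M
count-enumeration {P = P} P? ε ε-inj P⇔ε = trans (count-≡ P? U? P↣U U↣P) count-U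
  where
  index : ∀ {x} → P x → ∃ λ i → ε i ≡ x
  index {x} = Equivalence.to (P⇔ε x)

  P↣U : PredInjection P U
  P↣U = record
    { to     = proj₁ ∘ index
    ; to-∈   = λ _ → tt
    ; to-inj = λ p p′ eq → trans (sym (proj₂ (index p))) (trans (cong ε eq) (proj₂ (index p′)))
    }

  U↣P : PredInjection U P
  U↣P = record
    { to     = λ {i} _ → ε i
    ; to-∈   = λ {i} _ → Equivalence.from (P⇔ε (ε i)) (i , refl)
    ; to-inj = λ _ _ → ε-inj
    }

module _ (G : Graph) where
  open Graph G

  EdgesAt : Fin n → Pred (Fin m) 0ℓ
  EdgesAt v e = Inc e v

  EdgesAt? : ∀ v → Decidable (EdgesAt v)
  EdgesAt? v e = Inc? e v

  degree : Fin n → ℕ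
  degree v = count (EdgesAt v) (EdgesAt? v)

module _ {G : Graph} (E : PolyhedralEmbedding G) where
  open Graph G
  open PolyhedralEmbedding E

  FacesAt : Fin n → Pred (Fin k) 0ℓ
  FacesAt v f = OnV f v

  FacesAt? : ∀ v → Decidable (FacesAt v)
  FacesAt? v f = OnV? f v

  faceDegree : Fin n → ℕ
  faceDegree v = count (FacesAt v) (FacesAt? v)

  endpoint-on-face : ∀ {f e v} → OnE f e → Inc e v → OnV f v
  endpoint-on-face {f} (i , refl) v∈e with edge-joins f i | v∈e
  ... | inj₁ (end₁≡ , _) | inj₁ v≡end₁ = i      , sym (trans v≡end₁ end₁≡)
  ... | inj₁ (_ , end₂≡) | inj₂ v≡end₂ = next i , sym (trans v≡end₂ end₂≡)
  ... | inj₂ (end₁≡ , _) | inj₁ v≡end₁ = next i , sym (trans v≡end₁ end₁≡)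
  ... | inj₂ (_ , end₂≡) | inj₂ v≡end₂ = i      , sym (trans v≡end₂ end₂≡)

  faceDegree≡degree : ∀ v → faceDegree v ≡ degree G v
  faceDegree≡degree v with vertex-wheel v
  ... | _ , ε , φ , ε-inj , φ-inj , edges-at-v , faces-at-v , _ =
    trans (count-enumeration (FacesAt? v) φ φ-inj faces-at-v)
          (sym (count-enumeration (EdgesAt? G v) ε ε-inj edges-at-v))

  module _ (T : EdgeAssignment) where
    open EdgeAssignment T

    Assigned : Pred (Fin m) 0ℓ
    Assigned e = ∃ λ f → τ f ≡ e

    Assigned? : Decidable Assigned
    Assigned? e = any? (λ f → τ f ≟ᶠ e)

    AssignedTo : Fin n → Pred (Fin k) 0ℓ
    AssignedTo v f = Inc (τ f) v

    AssignedTo? : ∀ v → Decidable (AssignedTo v)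
    AssignedTo? v f = Inc? (τ f) v

    assignedDegree : Fin n → ℕ
    assignedDegree v = count (EdgesAt G v ∩ Assigned) (EdgesAt? G v ∩? Assigned?)

    assignedFaceDegree : Fin n → ℕ
    assignedFaceDegree v = count (FacesAt v ∩ AssignedTo v) (FacesAt? v ∩? AssignedTo? v)

    faceDegree-split : ∀ v → faceDegree v ≡ assignedFaceDegree v + sizeG*ᵥ v
    faceDegree-split v = count-split (AssignedTo v) (FacesAt? v) (AssignedTo? v)

    degree-split : ∀ v → degree G v ≡ assignedDegree v + degH v
    degree-split v = begin
      degree G v
        ≡⟨ count-split Assigned (EdgesAt? G v) Assigned? ⟩
      assignedDegree v + count (EdgesAt G v ∖ Assigned) unassigned?
        ≡⟨ cong (assignedDegree v +_) (count-cong unassigned? _ (swap , swap)) ⟩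
      assignedDegree v + degH v
        ∎
      where
      open ≡-Reasoning
      unassigned? : Decidable (EdgesAt G v ∖ Assigned)
      unassigned? = EdgesAt? G v ∩? ∁? Assigned?

    assignedFaceDegree≡assignedDegree : ∀ v → assignedFaceDegree v ≡ assignedDegree v
    assignedFaceDegree≡assignedDegree v = count-≡ _ _ τ↣ τ⁻¹↣
      where
      τ↣ : PredInjection (FacesAt v ∩ AssignedTo v) (EdgesAt G v ∩ Assigned)
      τ↣ = record
        { to     = λ {f} _ → τ f
        ; to-∈   = λ {f} (_ , v∈τf) → v∈τf , f , refl
        ; to-inj = λ _ _ → τ-inj
        }

      τ⁻¹↣ : PredInjection (EdgesAt G v ∩ Assigned) (FacesAt v ∩ AssignedTo v)
      τ⁻¹↣ = record
        { to     = λ (_ , f , _) → f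
        ; to-∈   = λ { (v∈e , f , refl) → endpoint-on-face (τ-on f) v∈e , v∈e }
        ; to-inj = λ { (_ , f , refl) (_ , _ , refl) → cong τ }
        }

proposition2 : (G : Graph) (Σ : PolyhedralEmbedding G)
    (T : PolyhedralEmbedding.EdgeAssignment Σ)
    (v : Fin (Graph.n G)) →
    PolyhedralEmbedding.EdgeAssignment.sizeG*ᵥ T v
    ≡ PolyhedralEmbedding.EdgeAssignment.degH T v
proposition2 G Σ T v = +-cancelˡ-≡ (assignedDegree Σ T v) _ _ (begin
  assignedDegree Σ T v + sizeG*ᵥ v
    ≡⟨ cong (_+ sizeG*ᵥ v) (assignedFaceDegree≡assignedDegree Σ T v) ⟨
  assignedFaceDegree Σ T v + sizeG*ᵥ v  ≡⟨ faceDegree-split Σ T v ⟨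
  faceDegree Σ v                        ≡⟨ faceDegree≡degree Σ v ⟩
  degree G v                            ≡⟨ degree-split Σ T v ⟩
  assignedDegree Σ T v + degH v         ∎)
  where
  open ≡-Reasoning
  open PolyhedralEmbedding.EdgeAssignment T
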